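{- For Boolean functions $f:\{0,1\}^n\to\{0,1\}$ and $g:\{0,1\}^m\to\{0,1\}$, $$\mathsf{fmbs}^{0}(f\circ g)\geq \mathsf{fmbs}^{0}(f)\,\mathsf{fmbs}^{0}(g).$$
   Context: $(f\circ g)(x^1,\dots,x^n)=f(g(x^1),\dots,g(x^n))$ for $x^i\in\{0,1\}^m$. For a Boolean function $h$ and input $x$, with $\mathrm{supp}(x)=\{i:x_i=1\}$ and $x^B$ the input $x$ with bits in $B$ flipped, a monotone sensitive block is a nonempty $B$ disjoint from $\mathrm{supp}(x)$ with $h(x^B)\ne h(x)$. $\mathsf{fmbs}(h,x)$ is the optimum of: maximize $\sum_{B\in W}b_B$ s.t. $\sum_{B\in W:i\in B}b_B\le1$ for every coordinate $i$, $b_B\in[0,1]$, where $W$ is the set of monotone sensitive blocks at $x$. $\mathsf{fmbs}^0(h)=\max_{x\in h^{ -1}(0)}\mathsf{fmbs}(h,x)$. -}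

module Defs where

open import Data.Bool using (Bool; true; false; _xor_; if_then_else_)
open import Data.Nat using (ℕ; zero; suc; _*_)
open import Data.Fin using (Fin)
open import Data.Vec using (Vec; []; _∷_; lookup; zipWith; map; take; drop)
open import Data.List using (List; []; _∷_; _++_; foldr) renaming (map to lmap)
open import Data.Rational using (ℚ; 0ℚ; 1ℚ; _+_; _≤_)
open import Data.Product using (Σ; ∃; _×_; _,_)
open import Relation.Binary.PropositionalEquality using (_≡_; _≢_)

BoolFn : ℕ → Set
BoolFn n = Vec Bool n → Bool

chunks : ∀ n m → Vec Bool (n * m) → Vec (Vec Bool m) n
chunks zero    m xs = []
chunks (suc n) m xs = take m xs ∷ chunks n m (drop m xs)

compose : ∀ {n m} → BoolFn n → BoolFn m → BoolFn (n * m)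
compose {n} {m} f g z = f (map g (chunks n m z))

-- All subsets (= characteristic vectors) of the coordinate set {0..n-1}.
allVecs : ∀ n → List (Vec Bool n)
allVecs zero    = [] ∷ []
allVecs (suc n) = lmap (true ∷_) (allVecs n) ++ lmap (false ∷_) (allVecs n)

flipBlock : ∀ {n} → Vec Bool n → Vec Bool n → Vec Bool n
flipBlock x B = zipWith _xor_ x B

MonoSensBlock : ∀ {n} → BoolFn n → Vec Bool n → Vec Bool n → Set
MonoSensBlock {n} h x B =
  (Σ (Fin n) λ i → lookup B i ≡ true)
  × (∀ (i : Fin n) → lookup B i ≡ true → lookup x i ≡ false)
  × (h (flipBlock x B) ≢ h x)

sumQ : List ℚ → ℚ
sumQ = foldr _+_ 0ℚ

-- A weighting b of all subsets of coordinates; it is a feasible solution of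
-- the fmbs LP at x if it vanishes outside W (the monotone sensitive blocks),
-- takes values in [0,1], and every coordinate is covered with total weight ≤ 1.
Feasible : ∀ {n} → BoolFn n → Vec Bool n → (Vec Bool n → ℚ) → Set
Feasible {n} h x b =
  (∀ B → b B ≢ 0ℚ → MonoSensBlock h x B)
  × (∀ B → 0ℚ ≤ b B)
  × (∀ B → b B ≤ 1ℚ)
  × (∀ (i : Fin n) →
       sumQ (lmap (λ B → if lookup B i then b B else 0ℚ) (allVecs n)) ≤ 1ℚ)

value : ∀ {n} → (Vec Bool n → ℚ) → ℚ
value {n} b = sumQ (lmap b (allVecs n))

-- v is fmbs⁰(h) = max over x ∈ h⁻¹(0) of the LP optimum fmbs(h,x):
-- v is attained by a feasible solution at some 0-input, and every feasible
-- solution at every 0-input has value ≤ v.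
IsFmbs0 : ∀ {n} → BoolFn n → ℚ → Set
IsFmbs0 {n} h v =
  (Σ (Vec Bool n) λ x → h x ≡ false ×
     Σ (Vec Bool n → ℚ) λ b → Feasible h x b × value b ≡ v)
  × (∀ (x : Vec Bool n) → h x ≡ false →
       ∀ (b : Vec Bool n → ℚ) → Feasible h x b → value b ≤ v)

-- Take an optimal fractional solution w_f at a 0-input x of f and one, w_g of value b, at a
-- 0-input y of g; q = w_g / b is a probability distribution on the sensitive blocks of g at y.
-- Feed f∘g the input whose i-th chunk is y when x_i = 0 and a 1-input y′ of g when x_i = 1.
-- Each sensitive block B of f at x, of weight w_f(B), is replaced by the random block whose
-- i-th chunk is drawn from q for i ∈ B and is empty otherwise: flipping it flips g on exactly
-- the chunks in B, so it is a sensitive block of f∘g.  Scaled by b, this has value b·val(w_f)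
-- and covers the j-th bit of chunk i with weight cov_g(j)·cov_f(i) ≤ 1.

module Submission where

open import Data.Bool using (Bool; true; false; not; _xor_; if_then_else_; _∨_)
open import Data.Bool.Properties using (xor-identityʳ; ¬-not)
open import Data.Fin using (Fin; zero; suc; combine; quotient; remainder)
open import Data.Fin.Properties using (combine-remQuot)
open import Data.List using ([]; _∷_) renaming (map to lmap; _++_ to _++ˡ_)
import Data.List.Properties as List
open import Data.Nat using (ℕ; zero; suc) renaming (_+_ to _+ℕ_; _*_ to _*ℕ_)
open import Data.Product using (Σ; _×_; _,_; proj₁; proj₂)
open import Data.Rational using (ℚ; 0ℚ; 1ℚ; _+_; _*_; _≤_; _≟_; 1/_; NonZero; Positive; ≢-nonZero; nonNegative)
open import Data.Rational.Properties
open import Data.Rational.Solver using (module +-*-Solver)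
open import Data.Vec using (Vec; []; _∷_; lookup; map; zipWith; concat; _++_; take; drop)
open import Data.Vec.Properties
  using (take++drop≡id; ++-injectiveˡ; ++-injectiveʳ; lookup-concat; lookup-map; zipWith-++)
open import Function using (_∘_)
open import Relation.Nullary using (yes; no)
open import Relation.Binary.PropositionalEquality

open import Defs

∑ : ∀ {k} → (Vec Bool k → ℚ) → ℚ
∑ {k} F = sumQ (lmap F (allVecs k))

coverage : ∀ {k} → (Vec Bool k → ℚ) → Fin k → ℚ
coverage w i = ∑ λ B → if lookup B i then w B else 0ℚ

sumQ-++ : ∀ xs ys → sumQ (xs ++ˡ ys) ≡ sumQ xs + sumQ ys
sumQ-++ []       ys = sym (+-identityˡ (sumQ ys))
sumQ-++ (x ∷ xs) ys = trans (cong (x +_) (sumQ-++ xs ys)) (sym (+-assoc x (sumQ xs) (sumQ ys)))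

sumQ-*ˡ : ∀ c xs → sumQ (lmap (c *_) xs) ≡ c * sumQ xs
sumQ-*ˡ c []       = sym (*-zeroʳ c)
sumQ-*ˡ c (x ∷ xs) = trans (cong (c * x +_) (sumQ-*ˡ c xs)) (sym (*-distribˡ-+ c x (sumQ xs)))

∑-cong : ∀ {k} {F G : Vec Bool k → ℚ} → (∀ u → F u ≡ G u) → ∑ F ≡ ∑ G
∑-cong {k} F≗G = cong sumQ (List.map-cong F≗G (allVecs k))

∑-*ˡ : ∀ {k} c (F : Vec Bool k → ℚ) → ∑ (λ u → c * F u) ≡ c * ∑ F
∑-*ˡ {k} c F = trans (cong sumQ (List.map-∘ (allVecs k))) (sumQ-*ˡ c (lmap F (allVecs k)))

∑-*ʳ : ∀ {k} c (F : Vec Bool k → ℚ) → ∑ (λ u → F u * c) ≡ ∑ F * c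
∑-*ʳ {k} c F = trans (∑-cong λ u → *-comm (F u) c) (trans (∑-*ˡ c F) (*-comm c (∑ {k} F)))

∑-∷ : ∀ {k} (F : Vec Bool (suc k) → ℚ) →
      ∑ F ≡ ∑ (λ u → F (true ∷ u)) + ∑ (λ u → F (false ∷ u))
∑-∷ {k} F = begin
  sumQ (lmap F (lmap (true ∷_) vs ++ˡ lmap (false ∷_) vs))
    ≡⟨ cong sumQ (List.map-++ F (lmap (true ∷_) vs) _) ⟩
  sumQ (lmap F (lmap (true ∷_) vs) ++ˡ lmap F (lmap (false ∷_) vs))
    ≡⟨ sumQ-++ (lmap F (lmap (true ∷_) vs)) _ ⟩
  sumQ (lmap F (lmap (true ∷_) vs)) + sumQ (lmap F (lmap (false ∷_) vs))
    ≡⟨ sym (cong₂ _+_ (cong sumQ (List.map-∘ vs)) (cong sumQ (List.map-∘ vs))) ⟩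
  ∑ (λ u → F (true ∷ u)) + ∑ (λ u → F (false ∷ u))  ∎
  where open ≡-Reasoning
        vs = allVecs k

∑-zero : ∀ {k} → ∑ {k} (λ _ → 0ℚ) ≡ 0ℚ
∑-zero {zero}  = +-identityˡ 0ℚ
∑-zero {suc k} = trans (∑-∷ {k} (λ _ → 0ℚ)) (trans (cong₂ _+_ (∑-zero {k}) (∑-zero {k})) (+-identityˡ 0ℚ))

if-*ˡ : ∀ b x y → (if b then x * y else 0ℚ) ≡ x * (if b then y else 0ℚ)
if-*ˡ true  x y = refl
if-*ˡ false x y = sym (*-zeroʳ x)

if-*ʳ : ∀ b x y → (if b then x * y else 0ℚ) ≡ (if b then x else 0ℚ) * y
if-*ʳ true  x y = refl
if-*ʳ false x y = sym (*-zeroˡ y)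

coverage-*ˡ : ∀ {k} c (w : Vec Bool k → ℚ) i → coverage (λ B → c * w B) i ≡ c * coverage w i
coverage-*ˡ c w i = trans (∑-cong λ B → if-*ˡ (lookup B i) c (w B)) (∑-*ˡ c (λ B → if lookup B i then w B else 0ℚ))

coverage-*ʳ : ∀ {k} c (w : Vec Bool k → ℚ) i → coverage (λ B → w B * c) i ≡ coverage w i * c
coverage-*ʳ c w i = trans (∑-cong λ B → if-*ʳ (lookup B i) (w B) c) (∑-*ʳ c (λ B → if lookup B i then w B else 0ℚ))

+-nonNeg : ∀ {p q} → 0ℚ ≤ p → 0ℚ ≤ q → 0ℚ ≤ p + q
+-nonNeg {p} {q} 0≤p 0≤q = subst (_≤ p + q) (+-identityˡ 0ℚ) (+-mono-≤ 0≤p 0≤q)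

if-nonNeg : ∀ b {x} → 0ℚ ≤ x → 0ℚ ≤ (if b then x else 0ℚ)
if-nonNeg true  0≤x = 0≤x
if-nonNeg false _   = ≤-refl

*-nonNeg : ∀ {p q} → 0ℚ ≤ p → 0ℚ ≤ q → 0ℚ ≤ p * q
*-nonNeg {p} {q} 0≤p 0≤q =
  nonNegative⁻¹ (p * q) {{nonNeg*nonNeg⇒nonNeg p {{nonNegative 0≤p}} q {{nonNegative 0≤q}}}}

*-≤1 : ∀ {p q} → 0ℚ ≤ p → p ≤ 1ℚ → 0ℚ ≤ q → q ≤ 1ℚ → p * q ≤ 1ℚ
*-≤1 {p} {q} 0≤p p≤1 0≤q q≤1 = begin
  p * q   ≤⟨ *-monoˡ-≤-nonNeg p {{nonNegative 0≤p}} q≤1 ⟩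
  p * 1ℚ  ≡⟨ *-identityʳ p ⟩
  p       ≤⟨ p≤1 ⟩
  1ℚ      ∎
  where open ≤-Reasoning

∑-nonNeg : ∀ {k} {F : Vec Bool k → ℚ} → (∀ u → 0ℚ ≤ F u) → 0ℚ ≤ ∑ F
∑-nonNeg {zero}      F≥0 = +-nonNeg (F≥0 []) ≤-refl
∑-nonNeg {suc k} {F} F≥0 = subst (0ℚ ≤_) (sym (∑-∷ F))
  (+-nonNeg (∑-nonNeg (F≥0 ∘ (true ∷_))) (∑-nonNeg (F≥0 ∘ (false ∷_))))

term≤∑ : ∀ {k} {F : Vec Bool k → ℚ} → (∀ u → 0ℚ ≤ F u) → ∀ u → F u ≤ ∑ F
term≤∑ {zero} {F} _ [] = ≤-reflexive (sym (+-identityʳ (F [])))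
term≤∑ {suc k} {F} F≥0 (true ∷ u) = begin
  F (true ∷ u)                                       ≤⟨ term≤∑ (F≥0 ∘ (true ∷_)) u ⟩
  ∑ (λ v → F (true ∷ v))                             ≡⟨ sym (+-identityʳ _) ⟩
  ∑ (λ v → F (true ∷ v)) + 0ℚ                        ≤⟨ +-monoʳ-≤ (∑ (λ v → F (true ∷ v))) (∑-nonNeg (F≥0 ∘ (false ∷_))) ⟩
  ∑ (λ v → F (true ∷ v)) + ∑ (λ v → F (false ∷ v))   ≡⟨ sym (∑-∷ F) ⟩
  ∑ F                                                ∎
  where open ≤-Reasoning
term≤∑ {suc k} {F} F≥0 (false ∷ u) = begin
  F (false ∷ u)                                      ≤⟨ term≤∑ (F≥0 ∘ (false ∷_)) u ⟩
  ∑ (λ v → F (false ∷ v))                            ≡⟨ sym (+-identityˡ _) ⟩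
  0ℚ + ∑ (λ v → F (false ∷ v))                       ≤⟨ +-monoˡ-≤ (∑ (λ v → F (false ∷ v))) (∑-nonNeg (F≥0 ∘ (true ∷_))) ⟩
  ∑ (λ v → F (true ∷ v)) + ∑ (λ v → F (false ∷ v))   ≡⟨ sym (∑-∷ F) ⟩
  ∑ F                                                ∎
  where open ≤-Reasoning

∑≢0⇒term≢0 : ∀ {k} (F : Vec Bool k → ℚ) → ∑ F ≢ 0ℚ → Σ (Vec Bool k) λ u → F u ≢ 0ℚ
∑≢0⇒term≢0 {zero} F ∑F≢0 = [] , λ F[]≡0 → ∑F≢0 (trans (cong (_+ 0ℚ) F[]≡0) (+-identityʳ 0ℚ))
∑≢0⇒term≢0 {suc k} F ∑F≢0 with ∑ (λ u → F (true ∷ u)) ≟ 0ℚ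
... | no ∑₁≢0 = let u , Fu≢0 = ∑≢0⇒term≢0 _ ∑₁≢0 in true ∷ u , Fu≢0
... | yes ∑₁≡0 =
  let u , Fu≢0 = ∑≢0⇒term≢0 (λ u → F (false ∷ u)) λ ∑₂≡0 →
                   ∑F≢0 (trans (∑-∷ F) (trans (cong₂ _+_ ∑₁≡0 ∑₂≡0) (+-identityˡ 0ℚ)))
  in false ∷ u , Fu≢0

nonempty : ∀ {k} → Vec Bool k → Bool
nonempty []      = false
nonempty (b ∷ u) = b ∨ nonempty u

lookup⇒nonempty : ∀ {k} (u : Vec Bool k) j → lookup u j ≡ true → nonempty u ≡ true
lookup⇒nonempty (true  ∷ u) zero    _  = refl
lookup⇒nonempty (true  ∷ u) (suc j) _  = refl
lookup⇒nonempty (false ∷ u) (suc j) uⱼ = lookup⇒nonempty u j uⱼ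

flipBlock-empty : ∀ {k} (w u : Vec Bool k) → nonempty u ≡ false → flipBlock w u ≡ w
flipBlock-empty []      []          _   = refl
flipBlock-empty (a ∷ w) (false ∷ u) u∅ = cong₂ _∷_ (xor-identityʳ a) (flipBlock-empty w u u∅)

-- Only the all-false vector is empty, so it alone contributes c.
∑-if-nonempty : ∀ {k} (A : Vec Bool k → ℚ) c →
  ∑ (λ u → if nonempty u then A u else c) ≡ c + ∑ (λ u → if nonempty u then A u else 0ℚ)
∑-if-nonempty {zero}  A c = cong (c +_) (sym (+-identityˡ 0ℚ))
∑-if-nonempty {suc k} A c = begin
  ∑ (λ u → if nonempty u then A u else c)
    ≡⟨ ∑-∷ (λ u → if nonempty u then A u else c) ⟩
  ∑ A₁ + ∑ (λ u → if nonempty u then A₀ u else c)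
    ≡⟨ cong (∑ A₁ +_) (∑-if-nonempty A₀ c) ⟩
  ∑ A₁ + (c + ∑ (λ u → if nonempty u then A₀ u else 0ℚ))
    ≡⟨ solve 3 (λ s c t → s :+ (c :+ t) := c :+ (s :+ t)) refl (∑ A₁) c (∑ (λ u → if nonempty u then A₀ u else 0ℚ)) ⟩
  c + (∑ A₁ + ∑ (λ u → if nonempty u then A₀ u else 0ℚ))
    ≡⟨ cong (c +_) (sym (∑-∷ (λ u → if nonempty u then A u else 0ℚ))) ⟩
  c + ∑ (λ u → if nonempty u then A u else 0ℚ) ∎
  where open ≡-Reasoning
        open +-*-Solver
        A₁ A₀ : Vec Bool k → ℚ
        A₁ u = A (true ∷ u)
        A₀ u = A (false ∷ u)

∑-++ : ∀ {p k} (F : Vec Bool (p +ℕ k) → ℚ) → ∑ F ≡ ∑ {p} λ u → ∑ {k} λ v → F (u ++ v)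
∑-++ {zero}  F = sym (+-identityʳ (∑ F))
∑-++ {suc p} {k} F = begin
  ∑ F                                                         ≡⟨ ∑-∷ F ⟩
  ∑ (λ w → F (true ∷ w)) + ∑ (λ w → F (false ∷ w))
    ≡⟨ cong₂ _+_ (∑-++ {p} {k} (λ w → F (true ∷ w))) (∑-++ {p} {k} (λ w → F (false ∷ w))) ⟩
  ∑ {p} (λ u → ∑ {k} λ v → F (true ∷ u ++ v)) + ∑ {p} (λ u → ∑ {k} λ v → F (false ∷ u ++ v))
    ≡⟨ sym (∑-∷ {p} (λ u → ∑ {k} λ v → F (u ++ v))) ⟩
  ∑ {suc p} (λ u → ∑ {k} λ v → F (u ++ v))                                ∎
  where open ≡-Reasoning

∑ᴮ : ∀ {n m} → (Vec (Vec Bool m) n → ℚ) → ℚ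
∑ᴮ {zero}  F = F []
∑ᴮ {suc n} F = ∑ λ u → ∑ᴮ λ us → F (u ∷ us)

∑ᴮ-cong : ∀ {n m} {F G : Vec (Vec Bool m) n → ℚ} → (∀ us → F us ≡ G us) → ∑ᴮ F ≡ ∑ᴮ G
∑ᴮ-cong {zero}  F≗G = F≗G []
∑ᴮ-cong {suc n} F≗G = ∑-cong λ u → ∑ᴮ-cong λ us → F≗G (u ∷ us)

∑ᴮ-*ˡ : ∀ {n m} c (F : Vec (Vec Bool m) n → ℚ) → ∑ᴮ (λ us → c * F us) ≡ c * ∑ᴮ F
∑ᴮ-*ˡ {zero}  c F = refl
∑ᴮ-*ˡ {suc n} c F = trans (∑-cong λ u → ∑ᴮ-*ˡ c λ us → F (u ∷ us)) (∑-*ˡ c (λ u → ∑ᴮ λ us → F (u ∷ us)))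

∑-concat : ∀ {n m} (F : Vec Bool (n *ℕ m) → ℚ) → ∑ F ≡ ∑ᴮ {n} {m} (λ us → F (concat us))
∑-concat {zero}  F = +-identityʳ (F [])
∑-concat {suc n} {m} F =
  trans (∑-++ {m} {n *ℕ m} F) (∑-cong λ u → ∑-concat {n} {m} λ v → F (u ++ v))

take-++ : ∀ {A : Set} {p k} (u : Vec A p) (v : Vec A k) → take p (u ++ v) ≡ u
take-++ {p = p} u v = ++-injectiveˡ (take p (u ++ v)) u (take++drop≡id p (u ++ v))

drop-++ : ∀ {A : Set} {p k} (u : Vec A p) (v : Vec A k) → drop p (u ++ v) ≡ v
drop-++ {p = p} u v = ++-injectiveʳ (take p (u ++ v)) u (take++drop≡id p (u ++ v))

chunks-concat : ∀ {n m} (us : Vec (Vec Bool m) n) → chunks n m (concat us) ≡ us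
chunks-concat []       = refl
chunks-concat (u ∷ us) = cong₂ _∷_ (take-++ u (concat us))
  (trans (cong (chunks _ _) (drop-++ u (concat us))) (chunks-concat us))

concat-chunks : ∀ n m (D : Vec Bool (n *ℕ m)) → concat (chunks n m D) ≡ D
concat-chunks zero    m [] = refl
concat-chunks (suc n) m D =
  trans (cong (take m D ++_) (concat-chunks n m (drop m D))) (take++drop≡id m D)

lookup-concat-remQuot : ∀ {A : Set} {n m} (xss : Vec (Vec A m) n) l →
  lookup (concat xss) l ≡ lookup (lookup xss (quotient {n} m l)) (remainder {n} m l)
lookup-concat-remQuot {n = n} {m} xss l =
  trans (cong (lookup (concat xss)) (sym (combine-remQuot {n} m l))) (lookup-concat xss _ _)

lookup-chunks : ∀ n m (D : Vec Bool (n *ℕ m)) l →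
  lookup D l ≡ lookup (lookup (chunks n m D) (quotient {n} m l)) (remainder {n} m l)
lookup-chunks n m D l =
  trans (cong (λ E → lookup E l) (sym (concat-chunks n m D))) (lookup-concat-remQuot (chunks n m D) l)

zipWith-concat : ∀ {A B C : Set} {n m} (h : A → B → C) (xss : Vec (Vec A m) n) (yss : Vec (Vec B m) n) →
  zipWith h (concat xss) (concat yss) ≡ concat (zipWith (zipWith h) xss yss)
zipWith-concat h []         []         = refl
zipWith-concat h (xs ∷ xss) (ys ∷ yss) =
  trans (zipWith-++ h xs (concat xss) ys (concat yss)) (cong (zipWith h xs ys ++_) (zipWith-concat h xss yss))

∑-chunks : ∀ {n m} (F : Vec (Vec Bool m) n → ℚ) → ∑ (λ D → F (chunks n m D)) ≡ ∑ᴮ {n} {m} F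
∑-chunks {n} {m} F = trans (∑-concat {n} {m} (λ D → F (chunks n m D))) (∑ᴮ-cong λ us → cong F (chunks-concat us))

module Spread {m} (q : Vec Bool m → ℚ) (q≥0 : ∀ u → 0ℚ ≤ q u) (∑q≡1 : ∑ q ≡ 1ℚ)
                  (q-empty : ∀ u → nonempty u ≡ false → q u ≡ 0ℚ) where

  chunkWeight : Vec Bool m → ℚ
  chunkWeight u = if nonempty u then q u else 1ℚ

  chunkWeight-nonempty : ∀ u → nonempty u ≡ true → chunkWeight u ≡ q u
  chunkWeight-nonempty u u≢∅ rewrite u≢∅ = refl

  chunkWeight-nonNeg : ∀ u → 0ℚ ≤ chunkWeight u
  chunkWeight-nonNeg u with nonempty u
  ... | true  = q≥0 u
  ... | false = nonNegative⁻¹ 1ℚ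

  ∑-chunkWeight : ∀ (G : Bool → ℚ) → ∑ (λ u → chunkWeight u * G (nonempty u)) ≡ G false + G true
  ∑-chunkWeight G = begin
    ∑ (λ u → chunkWeight u * G (nonempty u))
      ≡⟨ ∑-cong unfold ⟩
    ∑ (λ u → if nonempty u then q u * G true else G false)
      ≡⟨ ∑-if-nonempty (λ u → q u * G true) (G false) ⟩
    G false + ∑ (λ u → if nonempty u then q u * G true else 0ℚ)
      ≡⟨ cong (G false +_) (∑-cong drop-if) ⟩
    G false + ∑ (λ u → q u * G true)
      ≡⟨ cong (G false +_) (∑-*ʳ (G true) q) ⟩
    G false + ∑ q * G true
      ≡⟨ cong (λ s → G false + s * G true) ∑q≡1 ⟩
    G false + 1ℚ * G true
      ≡⟨ cong (G false +_) (*-identityˡ (G true)) ⟩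
    G false + G true ∎
    where
    open ≡-Reasoning
    unfold : ∀ u → chunkWeight u * G (nonempty u) ≡ (if nonempty u then q u * G true else G false)
    unfold u with nonempty u
    ... | true  = refl
    ... | false = *-identityˡ (G false)
    drop-if : ∀ u → (if nonempty u then q u * G true else 0ℚ) ≡ q u * G true
    drop-if u with nonempty u in u∅
    ... | true  = refl
    ... | false = sym (trans (cong (_* G true) (q-empty u u∅)) (*-zeroˡ (G true)))

  -- The mass φ B is distributed over the block families whose i-th chunk is empty when
  -- B i = 0 and distributed according to q when B i = 1.
  spread : ∀ {n} → (Vec Bool n → ℚ) → Vec (Vec Bool m) n → ℚ
  spread φ []       = φ []
  spread φ (u ∷ us) = chunkWeight u * spread (λ B → φ (nonempty u ∷ B)) us

  spread-nonNeg : ∀ {n} {φ : Vec Bool n → ℚ} → (∀ B → 0ℚ ≤ φ B) → ∀ us → 0ℚ ≤ spread φ us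
  spread-nonNeg φ≥0 []       = φ≥0 []
  spread-nonNeg φ≥0 (u ∷ us) =
    *-nonNeg (chunkWeight-nonNeg u) (spread-nonNeg (φ≥0 ∘ (nonempty u ∷_)) us)

  spread-support : ∀ {n} (φ : Vec Bool n → ℚ) us → spread φ us ≢ 0ℚ →
    φ (map nonempty us) ≢ 0ℚ × (∀ i → nonempty (lookup us i) ≡ true → q (lookup us i) ≢ 0ℚ)
  spread-support φ []       φ[]≢0 = φ[]≢0 , λ ()
  spread-support φ (u ∷ us) ≢0    =
    let φ≢0 , q≢0 = spread-support (φ ∘ (nonempty u ∷_)) us
                      λ ≡0 → ≢0 (trans (cong (chunkWeight u *_) ≡0) (*-zeroʳ (chunkWeight u)))
        qu≢0 : nonempty u ≡ true → q u ≢ 0ℚ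
        qu≢0 u≢∅ qu≡0 = ≢0 (trans (cong (_* spread (φ ∘ (nonempty u ∷_)) us)
                                     (trans (chunkWeight-nonempty u u≢∅) qu≡0))
                                (*-zeroˡ (spread (φ ∘ (nonempty u ∷_)) us)))
    in φ≢0 , λ { zero → qu≢0 ; (suc i) → q≢0 i }

  ∑ᴮ-spread : ∀ {n} (φ : Vec Bool n → ℚ) → ∑ᴮ (spread φ) ≡ ∑ φ
  ∑ᴮ-spread {zero}  φ = sym (+-identityʳ (φ []))
  ∑ᴮ-spread {suc n} φ = begin
    ∑ (λ u → ∑ᴮ λ us → chunkWeight u * spread (φ ∘ (nonempty u ∷_)) us)
      ≡⟨ ∑-cong (λ u → trans (∑ᴮ-*ˡ (chunkWeight u) (spread (φ ∘ (nonempty u ∷_))))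
                             (cong (chunkWeight u *_) (∑ᴮ-spread (φ ∘ (nonempty u ∷_))))) ⟩
    ∑ (λ u → chunkWeight u * ∑ (φ ∘ (nonempty u ∷_)))
      ≡⟨ ∑-chunkWeight (λ c → ∑ (φ ∘ (c ∷_))) ⟩
    ∑ (φ ∘ (false ∷_)) + ∑ (φ ∘ (true ∷_))
      ≡⟨ +-comm (∑ (φ ∘ (false ∷_))) _ ⟩
    ∑ (φ ∘ (true ∷_)) + ∑ (φ ∘ (false ∷_))
      ≡⟨ sym (∑-∷ φ) ⟩
    ∑ φ ∎
    where open ≡-Reasoning

  coverageᴮ-spread : ∀ {n} (φ : Vec Bool n → ℚ) i j →
    ∑ᴮ (λ us → if lookup (lookup us i) j then spread φ us else 0ℚ) ≡ coverage q j * coverage φ i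
  coverageᴮ-spread {suc n} φ zero j = begin
    ∑ (λ u → ∑ᴮ λ us → if lookup u j then chunkWeight u * spread (φ′ (nonempty u)) us else 0ℚ)
      ≡⟨ ∑-cong (λ u → trans (∑ᴮ-cong λ us → if-*ʳ (lookup u j) (chunkWeight u) (spread (φ′ (nonempty u)) us))
                             (∑ᴮ-*ˡ (if lookup u j then chunkWeight u else 0ℚ) (spread (φ′ (nonempty u))))) ⟩
    ∑ (λ u → (if lookup u j then chunkWeight u else 0ℚ) * ∑ᴮ (spread (φ′ (nonempty u))))
      ≡⟨ ∑-cong (λ u → cong ((if lookup u j then chunkWeight u else 0ℚ) *_) (∑ᴮ-spread (φ′ (nonempty u)))) ⟩
    ∑ (λ u → (if lookup u j then chunkWeight u else 0ℚ) * ∑ (φ′ (nonempty u)))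
      ≡⟨ ∑-cong hit ⟩
    ∑ (λ u → (if lookup u j then q u else 0ℚ) * ∑ (φ′ true))
      ≡⟨ ∑-*ʳ (∑ (φ′ true)) (λ u → if lookup u j then q u else 0ℚ) ⟩
    coverage q j * ∑ (φ′ true)
      ≡⟨ cong (coverage q j *_) (sym coverage-head) ⟩
    coverage q j * coverage φ zero ∎
    where
    open ≡-Reasoning
    φ′ : Bool → Vec Bool n → ℚ
    φ′ c B = φ (c ∷ B)
    hit : ∀ u → (if lookup u j then chunkWeight u else 0ℚ) * ∑ (φ′ (nonempty u))
              ≡ (if lookup u j then q u else 0ℚ) * ∑ (φ′ true)
    hit u with lookup u j in uⱼ
    ... | true  rewrite lookup⇒nonempty u j uⱼ = refl
    ... | false = trans (*-zeroˡ (∑ (φ′ (nonempty u)))) (sym (*-zeroˡ (∑ (φ′ true))))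
    coverage-head : coverage φ zero ≡ ∑ (φ′ true)
    coverage-head = trans (∑-∷ (λ B → if lookup B zero then φ B else 0ℚ))
                          (trans (cong (∑ (φ′ true) +_) (∑-zero {n})) (+-identityʳ (∑ (φ′ true))))
  coverageᴮ-spread {suc n} φ (suc i) j = begin
    ∑ (λ u → ∑ᴮ λ us → if lookup (lookup us i) j then chunkWeight u * spread (φ′ (nonempty u)) us else 0ℚ)
      ≡⟨ ∑-cong (λ u → trans (∑ᴮ-cong λ us → if-*ˡ (lookup (lookup us i) j) (chunkWeight u) (spread (φ′ (nonempty u)) us))
                             (∑ᴮ-*ˡ (chunkWeight u) (cover (nonempty u)))) ⟩
    ∑ (λ u → chunkWeight u * ∑ᴮ (cover (nonempty u)))
      ≡⟨ ∑-cong (λ u → cong (chunkWeight u *_) (coverageᴮ-spread (φ′ (nonempty u)) i j)) ⟩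
    ∑ (λ u → chunkWeight u * (coverage q j * coverage (φ′ (nonempty u)) i))
      ≡⟨ ∑-chunkWeight (λ c → coverage q j * coverage (φ′ c) i) ⟩
    coverage q j * coverage (φ′ false) i + coverage q j * coverage (φ′ true) i
      ≡⟨ sym (*-distribˡ-+ (coverage q j) (coverage (φ′ false) i) (coverage (φ′ true) i)) ⟩
    coverage q j * (coverage (φ′ false) i + coverage (φ′ true) i)
      ≡⟨ cong (coverage q j *_) (trans (+-comm (coverage (φ′ false) i) (coverage (φ′ true) i))
                                       (sym (∑-∷ (λ B → if lookup B (suc i) then φ B else 0ℚ)))) ⟩
    coverage q j * coverage φ (suc i) ∎
    where
    open ≡-Reasoning
    φ′ : Bool → Vec Bool n → ℚ
    φ′ c B = φ (c ∷ B)
    cover : Bool → Vec (Vec Bool m) n → ℚ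
    cover c us = if lookup (lookup us i) j then spread (φ′ c) us else 0ℚ

  spreadᶠ : ∀ {n} → (Vec Bool n → ℚ) → Vec Bool (n *ℕ m) → ℚ
  spreadᶠ {n} φ D = spread φ (chunks n m D)

  ∑-spreadᶠ : ∀ {n} (φ : Vec Bool n → ℚ) → ∑ (spreadᶠ φ) ≡ ∑ φ
  ∑-spreadᶠ φ = trans (∑-chunks (spread φ)) (∑ᴮ-spread φ)

  coverage-spreadᶠ : ∀ {n} (φ : Vec Bool n → ℚ) l →
    coverage (spreadᶠ φ) l ≡ coverage q (remainder {n} m l) * coverage φ (quotient {n} m l)
  coverage-spreadᶠ {n} φ l = begin
    ∑ (λ D → if lookup D l then spreadᶠ φ D else 0ℚ)
      ≡⟨ ∑-cong (λ D → cong (λ b → if b then spreadᶠ φ D else 0ℚ) (lookup-chunks n m D l)) ⟩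
    ∑ (λ D → cover (chunks n m D))
      ≡⟨ ∑-chunks cover ⟩
    ∑ᴮ cover
      ≡⟨ coverageᴮ-spread φ i j ⟩
    coverage q j * coverage φ i ∎
    where
    open ≡-Reasoning
    i = quotient {n} m l
    j = remainder {n} m l
    cover : Vec (Vec Bool m) n → ℚ
    cover us = if lookup (lookup us i) j then spread φ us else 0ℚ

value-nonNeg : ∀ {k} (h : BoolFn k) x {w} → Feasible h x w → 0ℚ ≤ value w
value-nonNeg h x (_ , w≥0 , _) = ∑-nonNeg w≥0

coverage-nonNeg : ∀ {k} {w : Vec Bool k → ℚ} → (∀ B → 0ℚ ≤ w B) → ∀ i → 0ℚ ≤ coverage w i
coverage-nonNeg {w = w} w≥0 i = ∑-nonNeg λ B → if-nonNeg (lookup B i) (w≥0 B)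

feasible : ∀ {k} {h : BoolFn k} {x} {w : Vec Bool k → ℚ} →
  (∀ B → w B ≢ 0ℚ → MonoSensBlock h x B) → (∀ B → 0ℚ ≤ w B) → (∀ i → coverage w i ≤ 1ℚ) →
  Feasible h x w
feasible {w = w} support w≥0 covered = support , w≥0 , w≤1 , covered
  where
  w≤1 : ∀ B → w B ≤ 1ℚ
  w≤1 B with w B ≟ 0ℚ
  ... | yes wB≡0 = subst (_≤ 1ℚ) (sym wB≡0) (nonNegative⁻¹ 1ℚ)
  ... | no  wB≢0 =
    let l , Bₗ = proj₁ (support B wB≢0) in begin
    w B                                    ≡⟨ cong (λ b → if b then w B else 0ℚ) (sym Bₗ) ⟩
    (if lookup B l then w B else 0ℚ)       ≤⟨ term≤∑ (λ B′ → if-nonNeg (lookup B′ l) (w≥0 B′)) B ⟩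
    coverage w l                           ≤⟨ covered l ⟩
    1ℚ                                     ∎
    where open ≤-Reasoning

module CompositeBlocks {n m} (f : BoolFn n) (g : BoolFn m) {y y′ : Vec Bool m}
                       (gy≡0 : g y ≡ false) (gy′≡1 : g y′ ≡ true) where

  inputFor : Bool → Vec Bool m
  inputFor c = if c then y′ else y

  g-inputFor : ∀ c → g (inputFor c) ≡ c
  g-inputFor true  = gy′≡1
  g-inputFor false = gy≡0

  lift : Vec Bool n → Vec Bool (n *ℕ m)
  lift x = concat (map inputFor x)

  map-g-inputFor : ∀ {k} (x : Vec Bool k) → map g (map inputFor x) ≡ x
  map-g-inputFor []      = refl
  map-g-inputFor (c ∷ x) = cong₂ _∷_ (g-inputFor c) (map-g-inputFor x)

  compose-lift : ∀ x → compose f g (lift x) ≡ f x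
  compose-lift x = cong f (trans (cong (map g) (chunks-concat (map inputFor x))) (map-g-inputFor x))

  g-flip-chunk : ∀ c u → (nonempty u ≡ true → MonoSensBlock g y u × c ≡ false) →
                 g (flipBlock (inputFor c) u) ≡ c xor nonempty u
  g-flip-chunk c u chunk with nonempty u in u≢∅
  ... | false = trans (cong g (flipBlock-empty (inputFor c) u u≢∅))
                      (trans (g-inputFor c) (sym (xor-identityʳ c)))
  ... | true with chunk refl
  ...   | (_ , _ , sensitive) , refl = trans (¬-not sensitive) (cong not gy≡0)

  map-g-flip : ∀ {k} (x : Vec Bool k) (us : Vec (Vec Bool m) k) →
    (∀ i → nonempty (lookup us i) ≡ true → MonoSensBlock g y (lookup us i) × lookup x i ≡ false) →
    map g (zipWith flipBlock (map inputFor x) us) ≡ flipBlock x (map nonempty us)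
  map-g-flip []      []       _     = refl
  map-g-flip (c ∷ x) (u ∷ us) chunk = cong₂ _∷_ (g-flip-chunk c u (chunk zero)) (map-g-flip x us (chunk ∘ suc))

  composite-block : ∀ x (us : Vec (Vec Bool m) n) →
    MonoSensBlock f x (map nonempty us) →
    (∀ i → nonempty (lookup us i) ≡ true → MonoSensBlock g y (lookup us i)) →
    MonoSensBlock (compose f g) (lift x) (concat us)
  composite-block x us ((i , Bᵢ) , disjoint , sensitive) chunk-block =
    nonempty-D , disjoint-D , sensitive-D
    where
    x-off : ∀ i → nonempty (lookup us i) ≡ true → lookup x i ≡ false
    x-off i uᵢ≢∅ = disjoint i (trans (lookup-map i nonempty us) uᵢ≢∅)

    nonempty-D : Σ (Fin (n *ℕ m)) λ l → lookup (concat us) l ≡ true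
    nonempty-D =
      let j , uᵢⱼ = proj₁ (chunk-block i (trans (sym (lookup-map i nonempty us)) Bᵢ))
      in combine i j , trans (lookup-concat us i j) uᵢⱼ

    disjoint-D : ∀ l → lookup (concat us) l ≡ true → lookup (lift x) l ≡ false
    disjoint-D l Dₗ = begin
      lookup (lift x) l                       ≡⟨ lookup-concat-remQuot (map inputFor x) l ⟩
      lookup (lookup (map inputFor x) i′) j   ≡⟨ cong (λ v → lookup v j) (lookup-map i′ inputFor x) ⟩
      lookup (inputFor (lookup x i′)) j       ≡⟨ cong (λ c → lookup (inputFor c) j) (x-off i′ uᵢ≢∅) ⟩
      lookup y j                              ≡⟨ proj₁ (proj₂ (chunk-block i′ uᵢ≢∅)) j uᵢⱼ ⟩
      false                                   ∎
      where
      open ≡-Reasoning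
      i′ = quotient {n} m l
      j  = remainder {n} m l
      uᵢⱼ : lookup (lookup us i′) j ≡ true
      uᵢⱼ = trans (sym (lookup-concat-remQuot us l)) Dₗ
      uᵢ≢∅ = lookup⇒nonempty (lookup us i′) j uᵢⱼ

    sensitive-D : compose f g (flipBlock (lift x) (concat us)) ≢ compose f g (lift x)
    sensitive-D flip≡ = sensitive (begin
      f (flipBlock x (map nonempty us))
        ≡⟨ cong f (sym (map-g-flip x us λ i uᵢ≢∅ → chunk-block i uᵢ≢∅ , x-off i uᵢ≢∅)) ⟩
      f (map g (zipWith flipBlock (map inputFor x) us))
        ≡⟨ cong (f ∘ map g) (sym (chunks-concat (zipWith flipBlock (map inputFor x) us))) ⟩
      f (map g (chunks n m (concat (zipWith flipBlock (map inputFor x) us))))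
        ≡⟨ cong (f ∘ map g ∘ chunks n m) (sym (zipWith-concat _xor_ (map inputFor x) us)) ⟩
      compose f g (flipBlock (lift x) (concat us))
        ≡⟨ flip≡ ⟩
      compose f g (lift x)
        ≡⟨ compose-lift x ⟩
      f x ∎)
      where open ≡-Reasoning

module Composition {n m} {f : BoolFn n} {g : BoolFn m} {x : Vec Bool n} {y : Vec Bool m}
  {wf : Vec Bool n → ℚ} {wg : Vec Bool m → ℚ}
  (feasible-f : Feasible f x wf) (gy≡0 : g y ≡ false) (feasible-g : Feasible g y wg)
  (value-g≢0 : value wg ≢ 0ℚ) where

  private
    b : ℚ
    b = value wg

    b-pos : Positive b
    b-pos = nonNeg∧nonZero⇒pos b {{nonNegative (value-nonNeg g y feasible-g)}} {{≢-nonZero value-g≢0}}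

    instance
      b-nonZero : NonZero b
      b-nonZero = pos⇒nonZero b {{b-pos}}

    b⁻¹ : ℚ
    b⁻¹ = 1/ b

    b⁻¹≥0 : 0ℚ ≤ b⁻¹
    b⁻¹≥0 = nonNegative⁻¹ b⁻¹ {{pos⇒nonNeg b⁻¹ {{1/pos⇒pos b {{b-pos}}}}}}

  q : Vec Bool m → ℚ
  q u = wg u * b⁻¹

  q-empty : ∀ u → nonempty u ≡ false → q u ≡ 0ℚ
  q-empty u u∅ with wg u ≟ 0ℚ
  ... | yes wgu≡0 = trans (cong (_* b⁻¹) wgu≡0) (*-zeroˡ b⁻¹)
  ... | no  wgu≢0 with proj₁ (proj₁ feasible-g u wgu≢0)
  ...   | j , uⱼ with trans (sym (lookup⇒nonempty u j uⱼ)) u∅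
  ...     | ()

  open Spread q (λ u → *-nonNeg (proj₁ (proj₂ feasible-g) u) b⁻¹≥0)
                (trans (∑-*ʳ b⁻¹ wg) (*-inverseʳ b)) q-empty

  g-one-input : Σ (Vec Bool m) λ y′ → g y′ ≡ true
  g-one-input =
    let C , wgC≢0 = ∑≢0⇒term≢0 wg value-g≢0
        _ , _ , sensitive = proj₁ feasible-g C wgC≢0
    in flipBlock y C , trans (¬-not sensitive) (cong not gy≡0)

  open CompositeBlocks f g gy≡0 (proj₂ g-one-input) public using (lift; compose-lift; composite-block)

  w : Vec Bool (n *ℕ m) → ℚ
  w D = b * spreadᶠ wf D

  value-w : value w ≡ value wg * value wf
  value-w = trans (∑-*ˡ b (spreadᶠ wf)) (cong (b *_) (∑-spreadᶠ wf))

  w-feasible : Feasible (compose f g) (lift x) w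
  w-feasible = feasible {h = compose f g} {x = lift x} support w≥0 covered
    where
    support : ∀ D → w D ≢ 0ℚ → MonoSensBlock (compose f g) (lift x) D
    support D wD≢0 =
      let us = chunks n m D
          wf≢0 , q≢0 = spread-support wf us λ ≡0 → wD≢0 (trans (cong (b *_) ≡0) (*-zeroʳ b))
          chunk-block : ∀ i → nonempty (lookup us i) ≡ true → MonoSensBlock g y (lookup us i)
          chunk-block i uᵢ≢∅ = proj₁ feasible-g (lookup us i) λ wg≡0 →
            q≢0 i uᵢ≢∅ (trans (cong (_* b⁻¹) wg≡0) (*-zeroˡ b⁻¹))
      in subst (MonoSensBlock (compose f g) (lift x)) (concat-chunks n m D)
               (composite-block x us (proj₁ feasible-f _ wf≢0) chunk-block)

    w≥0 : ∀ D → 0ℚ ≤ w D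
    w≥0 D = *-nonNeg (value-nonNeg g y feasible-g) (spread-nonNeg (proj₁ (proj₂ feasible-f)) (chunks n m D))

    covered : ∀ l → coverage w l ≤ 1ℚ
    covered l = begin
      coverage w l                                    ≡⟨ coverage-*ˡ b (spreadᶠ wf) l ⟩
      b * coverage (spreadᶠ wf) l                     ≡⟨ cong (b *_) (coverage-spreadᶠ wf l) ⟩
      b * (coverage q j * coverage wf i)              ≡⟨ cong (λ t → b * (t * coverage wf i)) (coverage-*ʳ b⁻¹ wg j) ⟩
      b * ((coverage wg j * b⁻¹) * coverage wf i)    ≡⟨ cancel (coverage wg j) (coverage wf i) ⟩
      coverage wg j * coverage wf i                   ≤⟨ *-≤1 (coverage-nonNeg (proj₁ (proj₂ feasible-g)) j) (proj₂ (proj₂ (proj₂ feasible-g)) j)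
                                                              (coverage-nonNeg (proj₁ (proj₂ feasible-f)) i) (proj₂ (proj₂ (proj₂ feasible-f)) i) ⟩
      1ℚ                                              ∎
      where
      open ≤-Reasoning
      i = quotient {n} m l
      j = remainder {n} m l
      cancel : ∀ s t → b * ((s * b⁻¹) * t) ≡ s * t
      cancel s t = begin-equality
        b * ((s * b⁻¹) * t)  ≡⟨ solve 4 (λ b s b⁻¹ t → b :* ((s :* b⁻¹) :* t) := (s :* t) :* (b :* b⁻¹)) refl b s b⁻¹ t ⟩
        (s * t) * (b * b⁻¹)  ≡⟨ cong ((s * t) *_) (*-inverseʳ b) ⟩
        (s * t) * 1ℚ          ≡⟨ *-identityʳ (s * t) ⟩
        s * t                 ∎
        where open +-*-Solver

lemma2 : ∀ {n m : ℕ} (f : BoolFn n) (g : BoolFn m) (a b c : ℚ) →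
    IsFmbs0 f a → IsFmbs0 g b → IsFmbs0 (compose f g) c →
    a * b ≤ c
lemma2 f g _ _ _ ((x , fx≡0 , wf , feasible-f , refl) , _) ((y , gy≡0 , wg , feasible-g , refl) , _)
       ((z , _ , w₀ , feasible₀ , refl) , optimal) with value wg ≟ 0ℚ
... | yes b≡0 = begin
  value wf * value wg  ≡⟨ cong (value wf *_) b≡0 ⟩
  value wf * 0ℚ        ≡⟨ *-zeroʳ (value wf) ⟩
  0ℚ                   ≤⟨ value-nonNeg (compose f g) z feasible₀ ⟩
  value w₀             ∎
  where open ≤-Reasoning
... | no b≢0 = begin
  value wf * value wg  ≡⟨ *-comm (value wf) (value wg) ⟩
  value wg * value wf  ≡⟨ sym value-w ⟩
  value w              ≤⟨ optimal (lift x) (trans (compose-lift x) fx≡0) w w-feasible ⟩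
  value w₀             ∎
  where open ≤-Reasoning
        open Composition {f = f} {g = g} {x = x} {y = y} feasible-f gy≡0 feasible-g b≢0
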